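{- For every term $M$, $\overline{[\![M]\!]\,k}=M$ (here $[\![M]\!]\,k$ is a computation combination of the form $TK$ with $T=[\![M]\!]$ and $K=k$).
   Context: Syntax. Fix a ring of scalars; $\alpha,\beta$ range over it. Terms: $M,N,L ::= V \mid MN \mid \alpha.M \mid M+N$; values $V ::= B \mid 0 \mid \alpha.V \mid V+W$; base values $B ::= x \mid \lambda x.M$, with $x$ ranging over an infinite set of variables. Terms are taken up to $\alpha$-conversion; application associates left and binds tighter than $+$ and $\alpha.$. CPS translation. The variables $k,b,b_1,b_2$ are reserved names distinct from all variables of source terms. $[\![x]\!]=\lambda k.kx$; $[\![\lambda x.M]\!]=\lambda k.k(\lambda x.[\![M]\!])$; $[\![MN]\!]=\lambda k.[\![M]\!](\lambda b_1.[\![N]\!](\lambda b_2.b_1b_2k))$; $[\![0]\!]=0$; $[\![\alpha.M]\!]=\lambda k.(\alpha.[\![M]\!])k$; $[\![M+N]\!]=\lambda k.([\![M]\!]+[\![N]\!])k$. CPS grammar. Base computations $C ::= KB \mid B_1B_2K \mid TK$; computation combinations $D ::= C \mid 0 \mid \alpha.D \mid D_1+D_2$; base suspensions $S ::= \lambda k.C$; suspension combinations $T ::= S \mid 0\mid \alpha.T \mid T_1+T_2$; continuations $K ::= k \mid \lambda b.BbK \mid \lambda b_1.T(\lambda b_2.b_1b_2K)$; CPS-values $B ::= x \mid \lambda x.S$ (with $x$ an ordinary, non-reserved variable). The reserved variable $k$ occurs only as the continuation $k$ and as the binder in $\lambda k.C$; $b,b_1,b_2$ occur only where displayed (they do not occur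 free in the displayed subterms $B,T,K$). Inverse translation: $\overline{KB}=\underline{K}[\psi(B)]$; $\overline{B_1B_2K}=\underline{K}[\psi(B_1)\psi(B_2)]$; $\overline{TK}=\underline{K}[\sigma(T)]$; $\overline{0}=0$; $\overline{\alpha.D}=\alpha.\overline{D}$; $\overline{D_1+D_2}=\overline{D_1}+\overline{D_2}$; $\sigma(\lambda k.C)=\overline{C}$; $\sigma(0)=0$; $\sigma(\alpha.T)=\alpha.\sigma(T)$; $\sigma(T_1+T_2)=\sigma(T_1)+\sigma(T_2)$; $\psi(x)=x$; $\psi(\lambda x.S)=\lambda x.\sigma(S)$; and for a term $M$: $\underline{k}[M]=M$; $\underline{\lambda b.BbK}[M]=\underline{K}[\psi(B)M]$; $\underline{\lambda b_1.T(\lambda b_2.b_1b_2K)}[M]=\underline{K}[M\,\sigma(T)]$. -}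

module Defs where

open import Level using (Level)
open import Data.Nat using (ℕ)

Var : Set
Var = ℕ

private variable a : Level

data Term (A : Set a) : Set a where
  var  : Var → Term A
  lam  : Var → Term A → Term A
  app  : Term A → Term A → Term A
  zero : Term A
  scal : A → Term A → Term A
  plus : Term A → Term A → Term A

-- CPS grammar.  The reserved variables k, b, b1, b2 are not represented by
-- names: they only occur at the displayed positions, so each production
-- records them implicitly.
mutual
  data Comp (A : Set a) : Set a where
    KB   : Cont A → CVal A → Comp A
    BBK  : CVal A → CVal A → Cont A → Comp A
    TK   : Susp A → Cont A → Comp A

  data CompC (A : Set a) : Set a where
    Dbase : Comp A → CompC A
    Dzero : CompC A
    Dscal : A → CompC A → CompC A
    Dplus : CompC A → CompC A → CompC A

  data BSusp (A : Set a) : Set a where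
    lamk : Comp A → BSusp A

  data Susp (A : Set a) : Set a where
    Tbase : BSusp A → Susp A
    Tzero : Susp A
    Tscal : A → Susp A → Susp A
    Tplus : Susp A → Susp A → Susp A

  -- Continuations  K ::= k | λb.B b K | λb1.T (λb2.b1 b2 K)
  data Cont (A : Set a) : Set a where
    kvar  : Cont A
    lamb  : CVal A → Cont A → Cont A
    lamb1 : Susp A → Cont A → Cont A

  data CVal (A : Set a) : Set a where
    cvar : Var → CVal A
    clam : Var → Susp A → CVal A

cps : {A : Set a} → Term A → Susp A
cps (var x)    = Tbase (lamk (KB kvar (cvar x)))
cps (lam x M)  = Tbase (lamk (KB kvar (clam x (cps M))))
cps (app M N)  = Tbase (lamk (TK (cps M) (lamb1 (cps N) kvar)))
cps zero       = Tzero
cps (scal α M) = Tbase (lamk (TK (Tscal α (cps M)) kvar))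
cps (plus M N) = Tbase (lamk (TK (Tplus (cps M) (cps N)) kvar))

mutual
  invC : {A : Set a} → Comp A → Term A
  invC (KB K B)      = plug K (ψ B)
  invC (BBK B1 B2 K) = plug K (app (ψ B1) (ψ B2))
  invC (TK T K)      = plug K (σ T)

  invD : {A : Set a} → CompC A → Term A
  invD (Dbase C)     = invC C
  invD Dzero         = zero
  invD (Dscal α D)   = scal α (invD D)
  invD (Dplus D₁ D₂) = plus (invD D₁) (invD D₂)

  σ : {A : Set a} → Susp A → Term A
  σ (Tbase (lamk C)) = invC C
  σ Tzero            = zero
  σ (Tscal α T)      = scal α (σ T)
  σ (Tplus T₁ T₂)    = plus (σ T₁) (σ T₂)

  ψ : {A : Set a} → CVal A → Term A
  ψ (cvar x)   = var x
  ψ (clam x T) = lam x (σ T)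

  plug : {A : Set a} → Cont A → Term A → Term A
  plug kvar        M = M
  plug (lamb B K)  M = plug K (app (ψ B) M)
  plug (lamb1 T K) M = plug K (app M (σ T))

module Submission where

-- The heart of the matter is that σ, the inverse translation on suspension
-- combinations, is a left inverse of the CPS translation: σ [[M]] = M for
-- every term M.  This is proved by structural induction on M; in each case
-- σ strips the administrative λk and the continuation built by [[-]]
-- (plugging into the trivial continuation k is the identity) and the claim
-- reduces to the induction hypotheses.
--
-- The theorem then follows because the inverse of the computation
-- [[M]] k is, by definition, σ [[M]] plugged into the empty context k.

open import Defs
open import Algebra.Bundles using (Ring)
open import Relation.Binary.PropositionalEquality using (_≡_; refl; cong; cong₂)

σ∘cps≡id : ∀ {a} {A : Set a} (M : Term A) → σ (cps M) ≡ M
σ∘cps≡id (var x)    = refl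
σ∘cps≡id (lam x M)  = cong (lam x) (σ∘cps≡id M)
σ∘cps≡id (app M N)  = cong₂ app (σ∘cps≡id M) (σ∘cps≡id N)
σ∘cps≡id zero       = refl
σ∘cps≡id (scal α M) = cong (scal α) (σ∘cps≡id M)
σ∘cps≡id (plus M N) = cong₂ plus (σ∘cps≡id M) (σ∘cps≡id N)

-- Lemma 3.5: the inverse translation of [[M]] k is M.  Since
-- invD (Dbase (TK T kvar)) reduces to plug kvar (σ T) = σ T, this is
-- exactly the left-inverse property above.
lemma3p5 : ∀ {c ℓ} (R : Ring c ℓ) (M : Term (Ring.Carrier R)) →
    invD (Dbase (TK (cps M) kvar)) ≡ M
lemma3p5 R M = σ∘cps≡id M
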